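{- Let $f$ be an involution on an alphabet. Let $x$ be a generalized palindrome, $y$ the longest generalized palindromic proper suffix of $x$, and $z$ the longest generalized palindromic proper suffix of $y$. Let $u$ and $v$ be strings such that $x=uy$ and $y=vz$. Then: (1) $|u|\ge |v|$; (2) if $|u|>|v|$ then $|u|>|z|$; (3) if $|u|=|v|$ then $u=v$.
   Context: An involution is a map $f$ on the alphabet with $f\circ f=\mathrm{id}$, extended letterwise to strings. For a string $x$, $x^R$ is its reverse, and $x$ is a generalized palindrome if $x=f(x^R)$. A proper suffix of $x$ is a suffix of $x$ different from $x$. -}

module Defs where

open import Data.List using (List; map; reverse; _++_; length)
open import Data.Nat using (_≤_)
open import Data.Product using (∃; _×_)
open import Relation.Binary.PropositionalEquality using (_≡_; _≢_)

IsInvolution : ∀ {a} {A : Set a} → (A → A) → Set a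
IsInvolution {A = A} f = ∀ (c : A) → f (f c) ≡ c

GenPal : ∀ {a} {A : Set a} → (A → A) → List A → Set a
GenPal f x = x ≡ map f (reverse x)

IsSuffix : ∀ {a} {A : Set a} → List A → List A → Set a
IsSuffix s x = ∃ λ w → x ≡ w ++ s

IsProperSuffix : ∀ {a} {A : Set a} → List A → List A → Set a
IsProperSuffix s x = IsSuffix s x × s ≢ x

IsLongestGPProperSuffix : ∀ {a} {A : Set a} → (A → A) → List A → List A → Set a
IsLongestGPProperSuffix f y x =
  (GenPal f y × IsProperSuffix y x) ×
  (∀ s → GenPal f s → IsProperSuffix s x → length s ≤ length y)

-- A generalized palindromic suffix of a generalized palindrome is also a prefix of it, and
-- conversely a border of a generalized palindrome is one. So y is a border of x = u y and z
-- one of y = v z, giving x the period |u| and y the period |v|. If |u| ≤ |y|, then y = u e for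
-- a palindromic border e of y, and |e| ≤ |z| yields |v| ≤ |u|; if |u| = |v|, then u and v are
-- prefixes of x of equal length. If |v| < |u| ≤ |z|, the periods |v| and |u| of y overlap
-- enough to give y, and then x, the period |u| − |v|; the resulting border of x is a
-- generalized palindromic proper suffix of length |v| + |y|, contradicting the maximality of y.
module Submission where

open import Defs
open import Data.List using (List; []; _∷_; _++_; length; map; reverse; take; drop)
open import Data.List.Properties
  using (∷-injective; ++-assoc; ++-identityʳ; reverse-++; map-++; length-map; length-reverse;
         length-++; length-take; take++drop≡id)
open import Data.Maybe using (Maybe; just; nothing)
open import Data.Nat using (ℕ; zero; suc; _+_; _≤_; _<_; z≤n; s≤s; _≤?_; _<?_)
open import Data.Nat.Properties
open import Data.Nat.Tactic.RingSolver using (solve-∀)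
open import Function using (_∘_)
open import Data.Product using (_×_; _,_; ∃; proj₂)
open import Relation.Nullary using (yes; no; contradiction)
open import Relation.Binary.PropositionalEquality

private
  shift : ∀ d q k → d + (q + k) ≡ q + d + k
  shift = solve-∀

  swap : ∀ d p k → d + (p + k) ≡ p + (d + k)
  swap = solve-∀

module _ {a} {A : Set a} where

  at : List A → ℕ → Maybe A
  at []      _       = nothing
  at (c ∷ w) zero    = just c
  at (c ∷ w) (suc i) = at w i

  at-++ˡ : ∀ (p q : List A) {i} → i < length p → at (p ++ q) i ≡ at p i
  at-++ˡ (c ∷ p) q {zero}  _         = refl
  at-++ˡ (c ∷ p) q {suc i} (s≤s i<p) = at-++ˡ p q i<p

  at-++ʳ : ∀ (p q : List A) k → at (p ++ q) (length p + k) ≡ at q k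
  at-++ʳ []      q k = refl
  at-++ʳ (c ∷ p) q k = at-++ʳ p q k

  at⇒prefix : ∀ (s w : List A) → length s ≤ length w →
              (∀ i → i < length s → at s i ≡ at w i) → ∃ λ r → w ≡ s ++ r
  at⇒prefix []      w       _         _  = w , refl
  at⇒prefix (c ∷ s) (d ∷ w) (s≤s s≤w) eq
    with refl ← eq zero (s≤s z≤n)
    with r , w≡sr ← at⇒prefix s w s≤w (λ i → eq (suc i) ∘ s≤s)
    = r , cong (c ∷_) w≡sr

  ++-injectiveˡ-length : ∀ (p r : List A) {q t} → p ++ q ≡ r ++ t → length p ≡ length r → p ≡ r
  ++-injectiveˡ-length []      []      _  _   = refl
  ++-injectiveˡ-length (c ∷ p) (d ∷ r) eq len with refl , eq′ ← ∷-injective eq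
    = cong (c ∷_) (++-injectiveˡ-length p r eq′ (suc-injective len))

  ++-equidivisible : ∀ (p q r t : List A) → p ++ q ≡ r ++ t → length p ≤ length r →
                     ∃ λ e → r ≡ p ++ e × q ≡ e ++ t
  ++-equidivisible []      q r       t eq _         = r , refl , eq
  ++-equidivisible (c ∷ p) q (d ∷ r) t eq (s≤s p≤r)
    with refl , eq′ ← ∷-injective eq
    with e , r≡pe , q≡et ← ++-equidivisible p q r t eq′ p≤r
    = e , cong (c ∷_) r≡pe , q≡et

  shorter⇒≢ : ∀ {s w : List A} → length s < length w → s ≢ w
  shorter⇒≢ s<w refl = <-irrefl refl s<w

  proper-suffix⇒0<length : ∀ {x u y : List A} → x ≡ u ++ y → y ≢ x → 0 < length u
  proper-suffix⇒0<length {u = []}    x≡y y≢x = contradiction (sym x≡y) y≢x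
  proper-suffix⇒0<length {u = _ ∷ _} _   _   = s≤s z≤n

  Periodic : ℕ → ℕ → List A → Set a
  Periodic n p w = ∀ i → p + i < n → at w (p + i) ≡ at w i

  periodic-≤ : ∀ {m n p w} → m ≤ n → Periodic n p w → Periodic m p w
  periodic-≤ m≤n per i pi<m = per i (<-≤-trans pi<m m≤n)

  repeated-factor⇒periodic : ∀ {w} (q s : List A) {r r′} →
                             w ≡ s ++ r → w ≡ q ++ s ++ r′ → Periodic (length q + length s) (length q) w
  repeated-factor⇒periodic {w} q s {r} {r′} w≡sr w≡qsr′ i qi<n = begin
    at w (length q + i)               ≡⟨ cong (λ t → at t (length q + i)) w≡qsr′ ⟩
    at (q ++ s ++ r′) (length q + i)  ≡⟨ at-++ʳ q (s ++ r′) i ⟩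
    at (s ++ r′) i                    ≡⟨ at-++ˡ s r′ i<s ⟩
    at s i                            ≡⟨ at-++ˡ s r i<s ⟨
    at (s ++ r) i                     ≡⟨ cong (λ t → at t i) w≡sr ⟨
    at w i                            ∎
    where
    open ≡-Reasoning
    i<s : i < length s
    i<s = +-cancelˡ-< (length q) i (length s) qi<n

  -- A weak form of the Fine–Wilf theorem.
  periodic-difference : ∀ {n q d p w} → q + d ≡ p → p + q ≤ n →
                        Periodic n q w → Periodic n p w → Periodic n d w
  periodic-difference {n} {q} {d} {w = w} refl p+q≤n per-q per-p j dj<n with q ≤? j
  ... | yes q≤j with k , refl ← m≤n⇒∃[o]m+o≡n q≤j = begin
    at w (d + (q + k))  ≡⟨ cong (at w) (shift d q k) ⟩
    at w (q + d + k)    ≡⟨ per-p k (subst (_< n) (shift d q k) dj<n) ⟩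
    at w k              ≡⟨ per-q k (≤-<-trans (m≤n+m (q + k) d) dj<n) ⟨
    at w (q + k)        ∎
    where open ≡-Reasoning
  ... | no j≱q = begin
    at w (d + j)        ≡⟨ per-q (d + j) (subst (_< n) (+-assoc q d j) pdj<n) ⟨
    at w (q + (d + j))  ≡⟨ cong (at w) (+-assoc q d j) ⟨
    at w (q + d + j)    ≡⟨ per-p j pdj<n ⟩
    at w j              ∎
    where
    open ≡-Reasoning
    pdj<n : q + d + j < n
    pdj<n = <-≤-trans (+-monoʳ-< (q + d) (≰⇒> j≱q)) p+q≤n

  periodic-extend : ∀ {m n q d p w} → q + d ≡ p → p ≤ n → m ≤ p + n →
                    Periodic m p w → Periodic n q w → Periodic n d w → Periodic m d w
  periodic-extend {m} {n} {q} {d} {w = w} refl p≤n m≤p+n per-p per-q per-d i di<m with q + d ≤? i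
  ... | yes p≤i with k , refl ← m≤n⇒∃[o]m+o≡n p≤i = begin
    at w (d + (q + d + k))  ≡⟨ cong (at w) (swap d (q + d) k) ⟩
    at w (q + d + (d + k))  ≡⟨ per-p (d + k) (subst (_< m) (swap d (q + d) k) di<m) ⟩
    at w (d + k)            ≡⟨ per-d k dk<n ⟩
    at w k                  ≡⟨ per-p k (≤-<-trans (m≤n+m (q + d + k) d) di<m) ⟨
    at w (q + d + k)        ∎
    where
    open ≡-Reasoning
    dk<n : d + k < n
    dk<n = +-cancelˡ-< (q + d) (d + k) n
             (<-≤-trans (subst (_< m) (swap d (q + d) k) di<m) m≤p+n)
  ... | no i≱p with q ≤? i
  ...   | yes q≤i with k , refl ← m≤n⇒∃[o]m+o≡n q≤i = begin
    at w (d + (q + k))  ≡⟨ cong (at w) (shift d q k) ⟩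
    at w (q + d + k)    ≡⟨ per-p k (subst (_< m) (shift d q k) di<m) ⟩
    at w k              ≡⟨ per-q k (<-≤-trans (≰⇒> i≱p) p≤n) ⟨
    at w (q + k)        ∎
    where open ≡-Reasoning
  ...   | no i≱q = per-d i (<-≤-trans (subst (d + i <_) (+-comm d q) (+-monoʳ-< d (≰⇒> i≱q))) p≤n)

  periodic⇒border : ∀ {w t s : List A} → w ≡ t ++ s → Periodic (length w) (length t) w →
                    ∃ λ r → w ≡ s ++ r
  periodic⇒border {w} {t} {s} w≡ts per = at⇒prefix s w s≤w λ i i<s → begin
    at s i                      ≡⟨ at-++ʳ t s i ⟨
    at (t ++ s) (length t + i)  ≡⟨ cong (λ x → at x (length t + i)) w≡ts ⟨
    at w (length t + i)         ≡⟨ per i (subst (length t + i <_) (sym ∣w∣) (+-monoʳ-< (length t) i<s)) ⟩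
    at w i                      ∎
    where
    open ≡-Reasoning
    ∣w∣ : length w ≡ length t + length s
    ∣w∣ = trans (cong length w≡ts) (length-++ t)
    s≤w : length s ≤ length w
    s≤w = subst (length s ≤_) (sym ∣w∣) (m≤n+m (length s) (length t))

  module _ (f : A → A) where

    mirror : List A → List A
    mirror w = map f (reverse w)

    mirror-++ : ∀ u y → mirror (u ++ y) ≡ mirror y ++ mirror u
    mirror-++ u y = trans (cong (map f) (reverse-++ u y)) (map-++ f (reverse y) (reverse u))

    genPal-suffix⇒prefix : ∀ {x u y} → GenPal f x → GenPal f y → x ≡ u ++ y → x ≡ y ++ mirror u
    genPal-suffix⇒prefix {x} {u} {y} x-pal y-pal x≡uy = begin
      x                    ≡⟨ x-pal ⟩
      mirror x             ≡⟨ cong mirror x≡uy ⟩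
      mirror (u ++ y)      ≡⟨ mirror-++ u y ⟩
      mirror y ++ mirror u ≡⟨ cong (_++ mirror u) y-pal ⟨
      y ++ mirror u        ∎
      where open ≡-Reasoning

    genPal-border : ∀ {x w p q} → GenPal f x → x ≡ w ++ p → x ≡ q ++ w → GenPal f w
    genPal-border {x} {w} {p} {q} x-pal x≡wp x≡qw =
      ++-injectiveˡ-length w (mirror w) wp≡w′q′ (sym (trans (length-map f (reverse w)) (length-reverse w)))
      where
      open ≡-Reasoning
      wp≡w′q′ : w ++ p ≡ mirror w ++ mirror q
      wp≡w′q′ = begin
        w ++ p               ≡⟨ x≡wp ⟨
        x                    ≡⟨ x-pal ⟩
        mirror x             ≡⟨ cong mirror x≡qw ⟩
        mirror (q ++ w)      ≡⟨ mirror-++ q w ⟩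
        mirror w ++ mirror q ∎

module PalindromicSuffixChain {a} {A : Set a} (f : A → A) {x y z u v : List A}
  (x-pal : GenPal f x) (y-pal : GenPal f y) (z-pal : GenPal f z)
  (x≡uy : x ≡ u ++ y) (y≡vz : y ≡ v ++ z) where

  u′ v′ : List A
  u′ = mirror f u
  v′ = mirror f v

  x≡yu′ : x ≡ y ++ u′
  x≡yu′ = genPal-suffix⇒prefix f x-pal y-pal x≡uy

  y≡zv′ : y ≡ z ++ v′
  y≡zv′ = genPal-suffix⇒prefix f y-pal z-pal y≡vz

  x≡vzu′ : x ≡ v ++ z ++ u′
  x≡vzu′ = trans x≡yu′ (trans (cong (_++ u′) y≡vz) (++-assoc v z u′))

  ∣x∣ : length x ≡ length u + length y
  ∣x∣ = trans (cong length x≡uy) (length-++ u)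

  ∣y∣ : length y ≡ length v + length z
  ∣y∣ = trans (cong length y≡vz) (length-++ v)

  ∣u∣≡∣v∣⇒u≡v : length u ≡ length v → u ≡ v
  ∣u∣≡∣v∣⇒u≡v = ++-injectiveˡ-length u v (trans (sym x≡uy) x≡vzu′)

  ∣v∣≤∣u∣ : 0 < length u → (∀ s → GenPal f s → IsProperSuffix s y → length s ≤ length z) →
            length v ≤ length u
  ∣v∣≤∣u∣ 0<∣u∣ z-longest with length u ≤? length y
  ... | no ∣u∣≰∣y∣ = begin
    length v               ≤⟨ m≤m+n (length v) (length z) ⟩
    length v + length z    ≡⟨ ∣y∣ ⟨
    length y               <⟨ ≰⇒> ∣u∣≰∣y∣ ⟩
    length u               ∎
    where open ≤-Reasoning
  ... | yes ∣u∣≤∣y∣ with e , y≡ue , y≡eu′ ← ++-equidivisible u y y u′ (trans (sym x≡uy) x≡yu′) ∣u∣≤∣y∣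
    = +-cancelʳ-≤ (length z) (length v) (length u) (begin
        length v + length z  ≡⟨ ∣y∣ ⟨
        length y             ≡⟨ ∣y∣≡∣u∣+∣e∣ ⟩
        length u + length e  ≤⟨ +-monoʳ-≤ (length u) ∣e∣≤∣z∣ ⟩
        length u + length z  ∎)
    where
    open ≤-Reasoning
    ∣y∣≡∣u∣+∣e∣ : length y ≡ length u + length e
    ∣y∣≡∣u∣+∣e∣ = trans (cong length y≡ue) (length-++ u)
    e≢y : e ≢ y
    e≢y = shorter⇒≢ (subst (length e <_) (sym ∣y∣≡∣u∣+∣e∣) (m<n+m (length e) 0<∣u∣))
    ∣e∣≤∣z∣ : length e ≤ length z
    ∣e∣≤∣z∣ = z-longest e (genPal-border f y-pal y≡eu′ y≡ue) ((u , y≡ue) , e≢y)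

  x-period-∣u∣-∣v∣ : ∀ {d} → length v + d ≡ length u → length u ≤ length z → Periodic (length x) d x
  x-period-∣u∣-∣v∣ {d} v+d≡u ∣u∣≤∣z∣ = subst (λ m → Periodic m d x) (sym ∣x∣)
    (periodic-extend {w = x} v+d≡u ∣u∣≤∣v∣+∣z∣ (≤-reflexive (cong (length u +_) ∣y∣))
      period-u period-v period-d-in-y)
    where
    ∣u∣≤∣v∣+∣z∣ : length u ≤ length v + length z
    ∣u∣≤∣v∣+∣z∣ = ≤-trans ∣u∣≤∣z∣ (m≤n+m (length z) (length v))
    period-u : Periodic (length u + length y) (length u) x
    period-u = repeated-factor⇒periodic u y x≡yu′ (trans x≡uy (cong (u ++_) (sym (++-identityʳ y))))
    period-v : Periodic (length v + length z) (length v) x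
    period-v = repeated-factor⇒periodic v z
      (trans x≡yu′ (trans (cong (_++ u′) y≡zv′) (++-assoc z v′ u′))) x≡vzu′
    period-d-in-y : Periodic (length v + length z) d x
    period-d-in-y = periodic-difference {w = x} v+d≡u
      (≤-trans (+-monoˡ-≤ (length v) ∣u∣≤∣z∣) (≤-reflexive (+-comm (length z) (length v))))
      period-v
      (periodic-≤ {w = x} (subst (_≤ length u + length y) ∣y∣ (m≤n+m (length y) (length u))) period-u)

  longer-genPal-suffix : length v < length u → length u ≤ length z →
                         ∃ λ s → GenPal f s × IsProperSuffix s x × length s ≡ length v + length y
  longer-genPal-suffix ∣v∣<∣u∣ ∣u∣≤∣z∣ with d , v+d≡u ← m≤n⇒∃[o]m+o≡n (<⇒≤ ∣v∣<∣u∣)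
    = s , genPal-border f x-pal (proj₂ border) x≡ts , ((t , x≡ts) , s≢x) , ∣s∣
    where
    t s : List A
    t = take d x
    s = drop d x
    x≡ts : x ≡ t ++ s
    x≡ts = sym (take++drop≡id d x)
    d≤∣x∣ : d ≤ length x
    d≤∣x∣ = begin
      d                    ≤⟨ m≤n+m d (length v) ⟩
      length v + d         ≡⟨ v+d≡u ⟩
      length u             ≤⟨ m≤m+n (length u) (length y) ⟩
      length u + length y  ≡⟨ ∣x∣ ⟨
      length x             ∎
      where open ≤-Reasoning
    ∣t∣ : length t ≡ d
    ∣t∣ = trans (length-take d x) (m≤n⇒m⊓n≡m d≤∣x∣)
    border : ∃ λ r → x ≡ s ++ r
    border = periodic⇒border x≡ts
      (subst (λ p → Periodic (length x) p x) (sym ∣t∣) (x-period-∣u∣-∣v∣ v+d≡u ∣u∣≤∣z∣))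
    ∣s∣ : length s ≡ length v + length y
    ∣s∣ = +-cancelˡ-≡ d (length s) (length v + length y) (begin
      d + length s               ≡⟨ cong (_+ length s) ∣t∣ ⟨
      length t + length s        ≡⟨ length-++ t ⟨
      length (t ++ s)            ≡⟨ cong length x≡ts ⟨
      length x                   ≡⟨ ∣x∣ ⟩
      length u + length y        ≡⟨ cong (_+ length y) v+d≡u ⟨
      length v + d + length y    ≡⟨ shift d (length v) (length y) ⟨
      d + (length v + length y)  ∎)
      where open ≡-Reasoning
    s≢x : s ≢ x
    s≢x = shorter⇒≢ (subst₂ _<_ (sym ∣s∣) (sym ∣x∣) (+-monoˡ-< (length y) ∣v∣<∣u∣))

  ∣v∣<∣u∣⇒∣z∣<∣u∣ : 0 < length v → (∀ s → GenPal f s → IsProperSuffix s x → length s ≤ length y) →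
                  length v < length u → length z < length u
  ∣v∣<∣u∣⇒∣z∣<∣u∣ 0<∣v∣ y-longest ∣v∣<∣u∣ with length z <? length u
  ... | yes ∣z∣<∣u∣ = ∣z∣<∣u∣
  ... | no ∣z∣≮∣u∣ with s , s-pal , s-suffix , ∣s∣ ← longer-genPal-suffix ∣v∣<∣u∣ (≮⇒≥ ∣z∣≮∣u∣)
    = contradiction (y-longest s s-pal s-suffix) (<⇒≱ (begin-strict
        length y             <⟨ m<n+m (length y) 0<∣v∣ ⟩
        length v + length y  ≡⟨ ∣s∣ ⟨
        length s             ∎))
    where open ≤-Reasoning

lemma4 : ∀ {a} {A : Set a} (f : A → A) → IsInvolution f →
         (x y z u v : List A) →
         GenPal f x →
         IsLongestGPProperSuffix f y x →
         IsLongestGPProperSuffix f z y →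
         x ≡ u ++ y → y ≡ v ++ z →
         (length v ≤ length u)
         × (length v < length u → length z < length u)
         × (length u ≡ length v → u ≡ v)
lemma4 f _ x y z u v x-pal ((y-pal , (_ , y≢x)) , y-longest) ((z-pal , (_ , z≢y)) , z-longest) x≡uy y≡vz =
    ∣v∣≤∣u∣ (proper-suffix⇒0<length x≡uy y≢x) z-longest
  , ∣v∣<∣u∣⇒∣z∣<∣u∣ (proper-suffix⇒0<length y≡vz z≢y) y-longest
  , ∣u∣≡∣v∣⇒u≡v
  where open PalindromicSuffixChain f x-pal y-pal z-pal x≡uy y≡vz
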